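{- Let $L$ be either of the sequent calculi $\mathrm{lTS4}$ or $\mathrm{gTS4}$ defined in the context. Then the rules ($\neg$left$^{ -1}$) $\Gamma\Rightarrow\Delta,\neg\alpha$ / $\alpha,\Gamma\Rightarrow\Delta$ and ($\neg$right$^{ -1}$) $\neg\alpha,\Gamma\Rightarrow\Delta$ / $\Gamma\Rightarrow\Delta,\alpha$ are admissible in cut-free $L$.
   Context: Formulas are built from countably many propositional variables using the binary connectives $\wedge,\vee,\to$ and the unary connectives $\neg,\Box,\Diamond$. Letters $\Gamma,\Delta$ (possibly with subscripts) denote finite, possibly empty, sets of formulas; a sequent is an expression $\Gamma\Rightarrow\Delta$; a comma denotes union. For a word $w$ over $\{\neg,\Box,\Diamond\}$, $w\Gamma=\{w\gamma:\gamma\in\Gamma\}$. A rule "$S_1;\dots;S_n\,/\,S$" has premises $S_1,\dots,S_n$ and conclusion $S$. "Cut-free $L$" means the system $L$ with the rule (cut) removed. A rule $R$ is admissible in a calculus $M$ if for every instance of $R$ with premises $S_1,\dots,S_n$ and conclusion $S$, whenever every $S_i$ is provable in $M$, $S$ is provable in $M$. The calculus lTS4. Initial sequents: for every propositional variable $p$: $p\Rightarrow p$, $\neg p\Rightarrow\neg p$, $\neg p,p\Rightarrow$, and $\Rightarrow\neg p,p$. Structural rules: (cut) $\Gamma\Rightarrow\alpha$; $\alpha,\Gamma\Rightarrow\Delta$ / $\Gamma\Rightarrow\Delta$. (we-left) $\Gamma\Rightarrow\Delta$ / $\alpha,\Gamma\Rightarrow\Delta$. (we-right) $\Gamma\Rightarrow\Delta$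 / $\Gamma\Rightarrow\Delta,\alpha$. Non-twist logical rules: ($\wedge$left) $\alpha,\beta,\Gamma\Rightarrow\Delta$ / $\alpha\wedge\beta,\Gamma\Rightarrow\Delta$. ($\wedge$right) $\Gamma\Rightarrow\Delta,\alpha$; $\Gamma\Rightarrow\Delta,\beta$ / $\Gamma\Rightarrow\Delta,\alpha\wedge\beta$. ($\vee$left) $\alpha,\Gamma\Rightarrow\Delta$; $\beta,\Gamma\Rightarrow\Delta$ / $\alpha\vee\beta,\Gamma\Rightarrow\Delta$. ($\vee$right) $\Gamma\Rightarrow\Delta,\alpha,\beta$ / $\Gamma\Rightarrow\Delta,\alpha\vee\beta$. ($\to$left) $\Gamma\Rightarrow\Delta,\alpha$; $\beta,\Gamma\Rightarrow\Delta$ / $\alpha\to\beta,\Gamma\Rightarrow\Delta$. ($\to$right) $\alpha,\Gamma\Rightarrow\Delta,\beta$ / $\Gamma\Rightarrow\Delta,\alpha\to\beta$. ($\Box$left) $\alpha,\Gamma\Rightarrow\Delta$ / $\Box\alpha,\Gamma\Rightarrow\Delta$. ($\Box$right) $\Box\Gamma_1,\neg\Diamond\Gamma_2\Rightarrow\Diamond\Delta_1,\neg\Box\Delta_2,\alpha$ / $\Box\Gamma_1,\neg\Diamond\Gamma_2\Rightarrow\Diamond\Delta_1,\neg\Box\Delta_2,\Box\alpha$. ($\Diamond$left) $\alpha,\Box\Gamma_1,\neg\Diamond\Gamma_2\Rightarrow\Diamond\Delta_1,\neg\Box\Delta_2$ / $\Diamond\alpha,\Box\Gamma_1,\neg\Diamond\Gamma_2\Rightarrow\Diamond\Delta_1,\neg\Box\Delta_2$.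 ($\Diamond$right) $\Gamma\Rightarrow\Delta,\alpha$ / $\Gamma\Rightarrow\Delta,\Diamond\alpha$. Twist rules: ($\neg\neg$left$^t$) $\alpha,\Gamma\Rightarrow\Delta$ / $\neg\neg\alpha,\Gamma\Rightarrow\Delta$. ($\neg\neg$right$^t$) $\Gamma\Rightarrow\Delta,\alpha$ / $\Gamma\Rightarrow\Delta,\neg\neg\alpha$. ($\neg\wedge$left$^t$) $\Gamma\Rightarrow\Delta,\alpha$; $\Gamma\Rightarrow\Delta,\beta$ / $\neg(\alpha\wedge\beta),\Gamma\Rightarrow\Delta$. ($\neg\wedge$right$^t$) $\alpha,\beta,\Gamma\Rightarrow\Delta$ / $\Gamma\Rightarrow\Delta,\neg(\alpha\wedge\beta)$. ($\neg\vee$left$^t$) $\Gamma\Rightarrow\Delta,\alpha,\beta$ / $\neg(\alpha\vee\beta),\Gamma\Rightarrow\Delta$. ($\neg\vee$right$^t$) $\alpha,\Gamma\Rightarrow\Delta$; $\beta,\Gamma\Rightarrow\Delta$ / $\Gamma\Rightarrow\Delta,\neg(\alpha\vee\beta)$. ($\neg\to$left$^t$) $\alpha,\Gamma\Rightarrow\Delta,\beta$ / $\neg(\alpha\to\beta),\Gamma\Rightarrow\Delta$. ($\neg\to$right$^t$) $\Gamma\Rightarrow\Delta,\alpha$; $\beta,\Gamma\Rightarrow\Delta$ / $\Gamma\Rightarrow\Delta,\neg(\alpha\to\beta)$. ($\neg\Box$left$^t$) $\Box\Gamma_1,\neg\Diamond\Gamma_2\Rightarrow\Diamond\Delta_1,\neg\Box\Delta_2,\alpha$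 / $\neg\Box\alpha,\Box\Gamma_1,\neg\Diamond\Gamma_2\Rightarrow\Diamond\Delta_1,\neg\Box\Delta_2$. ($\neg\Box$right$^t$) $\alpha,\Gamma\Rightarrow\Delta$ / $\Gamma\Rightarrow\Delta,\neg\Box\alpha$. ($\neg\Diamond$left$^t$) $\Gamma\Rightarrow\Delta,\alpha$ / $\neg\Diamond\alpha,\Gamma\Rightarrow\Delta$. ($\neg\Diamond$right$^t$) $\alpha,\Box\Gamma_1,\neg\Diamond\Gamma_2\Rightarrow\Diamond\Delta_1,\neg\Box\Delta_2$ / $\Box\Gamma_1,\neg\Diamond\Gamma_2\Rightarrow\Diamond\Delta_1,\neg\Box\Delta_2,\neg\Diamond\alpha$. The calculus gTS4 is obtained from lTS4 by replacing ($\Box$right), ($\Diamond$left), ($\neg\Box$left$^t$), ($\neg\Diamond$right$^t$) with: ($\Box$right$^T$) $\Box\Gamma_1,\Box\Delta_2\Rightarrow\Diamond\Delta_1,\Diamond\Gamma_2,\alpha$ / $\Box\Gamma_1,\neg\Diamond\Gamma_2\Rightarrow\Diamond\Delta_1,\neg\Box\Delta_2,\Box\alpha$. ($\Diamond$left$^T$) $\alpha,\Box\Gamma_1,\Box\Delta_2\Rightarrow\Diamond\Delta_1,\Diamond\Gamma_2$ / $\Diamond\alpha,\Box\Gamma_1,\neg\Diamond\Gamma_2\Rightarrow\Diamond\Delta_1,\neg\Box\Delta_2$. ($\neg\Box$left$^T$) $\Box\Gamma_1,\Box\Delta_2\Rightarrow\Diamond\Delta_1,\Diamond\Gamma_2,\alpha$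 / $\neg\Box\alpha,\Box\Gamma_1,\neg\Diamond\Gamma_2\Rightarrow\Diamond\Delta_1,\neg\Box\Delta_2$. ($\neg\Diamond$right$^T$) $\alpha,\Box\Gamma_1,\Box\Delta_2\Rightarrow\Diamond\Delta_1,\Diamond\Gamma_2$ / $\Box\Gamma_1,\neg\Diamond\Gamma_2\Rightarrow\Diamond\Delta_1,\neg\Box\Delta_2,\neg\Diamond\alpha$. (All other rules and initial sequents of lTS4, including ($\neg\Diamond$left$^t$), are kept.) -}

module Defs where

open import Data.Nat using (ℕ)
open import Data.Bool using (Bool; true; false)
open import Data.Product using (_×_; _,_; proj₁; proj₂)
open import Data.List using (List; []; _∷_; _++_; map)
open import Data.List.Relation.Binary.Subset.Propositional using (_⊆_)

data Fm : Set where
  var : ℕ → Fm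
  _∧̇_ _∨̇_ _⇒̇_ : Fm → Fm → Fm
  ¬̇_ □̇_ ◇̇_ : Fm → Fm

infixr 8 _∧̇_
infixr 7 _∨̇_
infixr 6 _⇒̇_
infix 9 ¬̇_ □̇_ ◇̇_

-- Finite sets of formulas are represented by lists, taken up to
-- extensional (membership) equality.
_≋_ : List Fm → List Fm → Set
xs ≋ ys = (xs ⊆ ys) × (ys ⊆ xs)

□s ◇s ¬◇s ¬□s : List Fm → List Fm
□s = map □̇_
◇s = map ◇̇_
¬◇s Γ = map (λ a → ¬̇ ◇̇ a) Γ
¬□s Γ = map (λ a → ¬̇ □̇ a) Γ

data Calc : Set where
  lTS4 gTS4 : Calc

data _≡B_ : Bool → Bool → Set where
  reflB : ∀ {b} → b ≡B b

data _≡C_ : Calc → Calc → Set where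
  reflC : ∀ {L} → L ≡C L

-- Derivable L c Γ Δ : the sequent Γ ⇒ Δ is provable in L;
-- c = true : with (cut), c = false : cut-free L.
data Derivable (L : Calc) (c : Bool) : List Fm → List Fm → Set where
  -- sequents are sets: a derivable sequent stays derivable under
  -- set-equality of antecedent and succedent
  set-eq : ∀ {Γ Γ' Δ Δ'} → Γ ≋ Γ' → Δ ≋ Δ' →
           Derivable L c Γ Δ → Derivable L c Γ' Δ'
  ax1 : ∀ p → Derivable L c (var p ∷ []) (var p ∷ [])
  ax2 : ∀ p → Derivable L c (¬̇ var p ∷ []) (¬̇ var p ∷ [])
  ax3 : ∀ p → Derivable L c (¬̇ var p ∷ var p ∷ []) []
  ax4 : ∀ p → Derivable L c [] (¬̇ var p ∷ var p ∷ [])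
  cut : ∀ {Γ Δ α} → c ≡B true → Derivable L c Γ (α ∷ []) → Derivable L c (α ∷ Γ) Δ →
        Derivable L c Γ Δ
  weL : ∀ {Γ Δ α} → Derivable L c Γ Δ → Derivable L c (α ∷ Γ) Δ
  weR : ∀ {Γ Δ α} → Derivable L c Γ Δ → Derivable L c Γ (Δ ++ α ∷ [])
  ∧L : ∀ {Γ Δ α β} → Derivable L c (α ∷ β ∷ Γ) Δ → Derivable L c (α ∧̇ β ∷ Γ) Δ
  ∧R : ∀ {Γ Δ α β} → Derivable L c Γ (Δ ++ α ∷ []) → Derivable L c Γ (Δ ++ β ∷ []) →
       Derivable L c Γ (Δ ++ α ∧̇ β ∷ [])
  ∨L : ∀ {Γ Δ α β} → Derivable L c (α ∷ Γ) Δ → Derivable L c (β ∷ Γ) Δ →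
       Derivable L c (α ∨̇ β ∷ Γ) Δ
  ∨R : ∀ {Γ Δ α β} → Derivable L c Γ (Δ ++ α ∷ β ∷ []) → Derivable L c Γ (Δ ++ α ∨̇ β ∷ [])
  ⇒L : ∀ {Γ Δ α β} → Derivable L c Γ (Δ ++ α ∷ []) → Derivable L c (β ∷ Γ) Δ →
       Derivable L c (α ⇒̇ β ∷ Γ) Δ
  ⇒R : ∀ {Γ Δ α β} → Derivable L c (α ∷ Γ) (Δ ++ β ∷ []) → Derivable L c Γ (Δ ++ α ⇒̇ β ∷ [])
  □L : ∀ {Γ Δ α} → Derivable L c (α ∷ Γ) Δ → Derivable L c (□̇ α ∷ Γ) Δ
  ◇R : ∀ {Γ Δ α} → Derivable L c Γ (Δ ++ α ∷ []) → Derivable L c Γ (Δ ++ ◇̇ α ∷ [])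
  ¬¬L : ∀ {Γ Δ α} → Derivable L c (α ∷ Γ) Δ → Derivable L c (¬̇ ¬̇ α ∷ Γ) Δ
  ¬¬R : ∀ {Γ Δ α} → Derivable L c Γ (Δ ++ α ∷ []) → Derivable L c Γ (Δ ++ ¬̇ ¬̇ α ∷ [])
  ¬∧L : ∀ {Γ Δ α β} → Derivable L c Γ (Δ ++ α ∷ []) → Derivable L c Γ (Δ ++ β ∷ []) →
        Derivable L c (¬̇ (α ∧̇ β) ∷ Γ) Δ
  ¬∧R : ∀ {Γ Δ α β} → Derivable L c (α ∷ β ∷ Γ) Δ → Derivable L c Γ (Δ ++ ¬̇ (α ∧̇ β) ∷ [])
  ¬∨L : ∀ {Γ Δ α β} → Derivable L c Γ (Δ ++ α ∷ β ∷ []) → Derivable L c (¬̇ (α ∨̇ β) ∷ Γ) Δ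
  ¬∨R : ∀ {Γ Δ α β} → Derivable L c (α ∷ Γ) Δ → Derivable L c (β ∷ Γ) Δ →
        Derivable L c Γ (Δ ++ ¬̇ (α ∨̇ β) ∷ [])
  ¬⇒L : ∀ {Γ Δ α β} → Derivable L c (α ∷ Γ) (Δ ++ β ∷ []) → Derivable L c (¬̇ (α ⇒̇ β) ∷ Γ) Δ
  ¬⇒R : ∀ {Γ Δ α β} → Derivable L c Γ (Δ ++ α ∷ []) → Derivable L c (β ∷ Γ) Δ →
        Derivable L c Γ (Δ ++ ¬̇ (α ⇒̇ β) ∷ [])
  ¬□R : ∀ {Γ Δ α} → Derivable L c (α ∷ Γ) Δ → Derivable L c Γ (Δ ++ ¬̇ □̇ α ∷ [])
  ¬◇L : ∀ {Γ Δ α} → Derivable L c Γ (Δ ++ α ∷ []) → Derivable L c (¬̇ ◇̇ α ∷ Γ) Δ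
  □R-l : ∀ {Γ₁ Γ₂ Δ₁ Δ₂ α} → L ≡C lTS4 →
         Derivable L c (□s Γ₁ ++ ¬◇s Γ₂) (◇s Δ₁ ++ ¬□s Δ₂ ++ α ∷ []) →
         Derivable L c (□s Γ₁ ++ ¬◇s Γ₂) (◇s Δ₁ ++ ¬□s Δ₂ ++ □̇ α ∷ [])
  ◇L-l : ∀ {Γ₁ Γ₂ Δ₁ Δ₂ α} → L ≡C lTS4 →
         Derivable L c (α ∷ □s Γ₁ ++ ¬◇s Γ₂) (◇s Δ₁ ++ ¬□s Δ₂) →
         Derivable L c (◇̇ α ∷ □s Γ₁ ++ ¬◇s Γ₂) (◇s Δ₁ ++ ¬□s Δ₂)
  ¬□L-l : ∀ {Γ₁ Γ₂ Δ₁ Δ₂ α} → L ≡C lTS4 →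
         Derivable L c (□s Γ₁ ++ ¬◇s Γ₂) (◇s Δ₁ ++ ¬□s Δ₂ ++ α ∷ []) →
         Derivable L c (¬̇ □̇ α ∷ □s Γ₁ ++ ¬◇s Γ₂) (◇s Δ₁ ++ ¬□s Δ₂)
  ¬◇R-l : ∀ {Γ₁ Γ₂ Δ₁ Δ₂ α} → L ≡C lTS4 →
         Derivable L c (α ∷ □s Γ₁ ++ ¬◇s Γ₂) (◇s Δ₁ ++ ¬□s Δ₂) →
         Derivable L c (□s Γ₁ ++ ¬◇s Γ₂) (◇s Δ₁ ++ ¬□s Δ₂ ++ ¬̇ ◇̇ α ∷ [])
  □R-g : ∀ {Γ₁ Γ₂ Δ₁ Δ₂ α} → L ≡C gTS4 →
         Derivable L c (□s Γ₁ ++ □s Δ₂) (◇s Δ₁ ++ ◇s Γ₂ ++ α ∷ []) →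
         Derivable L c (□s Γ₁ ++ ¬◇s Γ₂) (◇s Δ₁ ++ ¬□s Δ₂ ++ □̇ α ∷ [])
  ◇L-g : ∀ {Γ₁ Γ₂ Δ₁ Δ₂ α} → L ≡C gTS4 →
         Derivable L c (α ∷ □s Γ₁ ++ □s Δ₂) (◇s Δ₁ ++ ◇s Γ₂) →
         Derivable L c (◇̇ α ∷ □s Γ₁ ++ ¬◇s Γ₂) (◇s Δ₁ ++ ¬□s Δ₂)
  ¬□L-g : ∀ {Γ₁ Γ₂ Δ₁ Δ₂ α} → L ≡C gTS4 →
         Derivable L c (□s Γ₁ ++ □s Δ₂) (◇s Δ₁ ++ ◇s Γ₂ ++ α ∷ []) →
         Derivable L c (¬̇ □̇ α ∷ □s Γ₁ ++ ¬◇s Γ₂) (◇s Δ₁ ++ ¬□s Δ₂)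
  ¬◇R-g : ∀ {Γ₁ Γ₂ Δ₁ Δ₂ α} → L ≡C gTS4 →
         Derivable L c (α ∷ □s Γ₁ ++ □s Δ₂) (◇s Δ₁ ++ ◇s Γ₂) →
         Derivable L c (□s Γ₁ ++ ¬◇s Γ₂) (◇s Δ₁ ++ ¬□s Δ₂ ++ ¬̇ ◇̇ α ∷ [])

CutFree : Calc → List Fm → List Fm → Set
CutFree L = Derivable L false

Admissible₁ : Calc → (List Fm → List Fm → Fm → List Fm × List Fm)
              → (List Fm → List Fm → Fm → List Fm × List Fm) → Set
Admissible₁ L prem concl = ∀ Γ Δ α →
  CutFree L (proj₁ (prem Γ Δ α)) (proj₂ (prem Γ Δ α)) →
  CutFree L (proj₁ (concl Γ Δ α)) (proj₂ (concl Γ Δ α))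

¬left⁻¹-prem ¬left⁻¹-concl ¬right⁻¹-prem ¬right⁻¹-concl :
  List Fm → List Fm → Fm → List Fm × List Fm
¬left⁻¹-prem  Γ Δ α = Γ , Δ ++ ¬̇ α ∷ []
¬left⁻¹-concl Γ Δ α = α ∷ Γ , Δ
¬right⁻¹-prem  Γ Δ α = ¬̇ α ∷ Γ , Δ
¬right⁻¹-concl Γ Δ α = Γ , Δ ++ α ∷ []

-- Both rules are instances of one statement, proved by induction on cut-free
-- derivations: formulas may be moved across the sequent arrow, becoming their
-- complements (neg strips a leading ¬ and otherwise adds one).  If Γ ⇒ Θ is
-- derivable and every formula of Θ lies in M or in Δ, then Γ, neg M ⇒ Δ is
-- derivable, and dually; the two rules are the case M = [¬α], as neg ¬α = α.
--
-- If its principal formula φ is in M, the rule is replaced by its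
-- twist dual, which has the same premises and introduces neg φ on the other
-- side; for ¬¬α the premise is treated with α added to M.  In a modal rule
-- only the modal context formulas can be in M: ◇δ and ¬□δ on the right become
-- ¬◇δ and □δ on the left (□δ and ¬◇δ on the left become ¬□δ and ◇δ on the
-- right), i.e. they switch to the other modal context of the same rule.  For
-- lTS4 they are moved in the premise by the induction hypothesis; the premises
-- of the gTS4 rules already contain them in the required form.

module Submission where

open import Defs
open import Data.Product using (_×_; _,_)
open import Data.Sum using (inj₁; inj₂)
open import Data.List using (List; []; _∷_; _++_; map; [_])
open import Data.List.Properties using (++-assoc; ++-identityʳ; map-++; map-∘)
open import Data.List.Membership.Propositional using (_∈_)
open import Data.List.Membership.Propositional.Properties
  using (∈-map⁺; ∈-++⁺ˡ; ∈-++⁺ʳ; ∈-++⁻)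
open import Data.List.Relation.Binary.Subset.Propositional using (_⊆_)
open import Data.List.Relation.Binary.Subset.Propositional.Properties
  using (⊆-refl; ⊆-trans; ⊆-reflexive; ⊆-reflexive-↭; xs⊆xs++ys; xs⊆ys++xs; xs⊆x∷xs;
         ++⁺; ++⁺ʳ; ++⁺ˡ; ∷⁺ʳ; ∈-∷⁺ʳ; map⁺; module ⊆-Reasoning)
open import Data.List.Relation.Binary.Permutation.Propositional.Properties using (++-comm; shift)
open import Data.List.Relation.Unary.Any using (here; there)
open import Function using (_∘_)
open import Relation.Binary.PropositionalEquality
  using (_≡_; refl; sym; trans; cong; cong₂; subst; module ≡-Reasoning)

private
  variable
    A : Set
    x : A
    xs ys zs : List A

++-⊆ : xs ⊆ zs → ys ⊆ zs → xs ++ ys ⊆ zs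
++-⊆ {xs = xs} xs⊆ ys⊆ v∈ with ∈-++⁻ xs v∈
... | inj₁ v∈xs = xs⊆ v∈xs
... | inj₂ v∈ys = ys⊆ v∈ys

++-⊆⁻ˡ : xs ++ ys ⊆ zs → xs ⊆ zs
++-⊆⁻ˡ {ys = ys} h = ⊆-trans (xs⊆xs++ys _ ys) h

++-⊆⁻ʳ : xs ++ ys ⊆ zs → ys ⊆ zs
++-⊆⁻ʳ {xs = xs} h = ⊆-trans (xs⊆ys++xs _ xs) h

[]⊆ : [] ⊆ xs
[]⊆ ()

[_]⊆ : x ∈ xs → [ x ] ⊆ xs
[ x∈ ]⊆ = ∈-∷⁺ʳ x∈ []⊆

last∈ : xs ++ [ x ] ⊆ zs → x ∈ zs
last∈ h = ++-⊆⁻ʳ h (here refl)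

⊆-medial : ∀ (ws xs ys zs : List A) → (ws ++ xs) ++ (ys ++ zs) ⊆ (ws ++ ys) ++ (xs ++ zs)
⊆-medial ws xs ys zs =
  ++-⊆ (++-⊆ (⊆-trans (xs⊆xs++ys ws ys) (xs⊆xs++ys _ (xs ++ zs)))
             (⊆-trans (xs⊆xs++ys xs zs) (xs⊆ys++xs _ (ws ++ ys))))
       (++-⊆ (⊆-trans (xs⊆ys++xs ys ws) (xs⊆xs++ys _ (xs ++ zs)))
             (⊆-trans (xs⊆ys++xs zs xs) (xs⊆ys++xs _ (ws ++ ys))))

extendʳ : ∀ ys ws → xs ⊆ ys ++ zs → xs ++ ws ⊆ ys ++ (zs ++ ws)
extendʳ {zs = zs} ys ws h =
  ++-⊆ (⊆-trans h (++⁺ʳ ys (xs⊆xs++ys zs ws)))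
       (⊆-trans (xs⊆ys++xs ws zs) (xs⊆ys++xs _ ys))

extendˡ : ∀ ys ws → xs ⊆ ys ++ zs → ws ++ xs ⊆ ys ++ (ws ++ zs)
extendˡ {zs = zs} ys ws h =
  ++-⊆ (⊆-trans (xs⊆xs++ys ws zs) (xs⊆ys++xs _ ys))
       (⊆-trans h (++⁺ʳ ys (xs⊆ys++xs zs ws)))

init⊆ : ∀ xs {ys us zs : List A} → xs ++ ys ++ us ⊆ zs → xs ++ ys ⊆ zs
init⊆ xs {ys} {us} h = ⊆-trans (++⁺ʳ xs (xs⊆xs++ys ys us)) h

++-rotate-⊆ : ∀ (xs ys zs : List A) → (xs ++ ys) ++ zs ⊆ ys ++ (zs ++ xs)
++-rotate-⊆ xs ys zs = begin
  (xs ++ ys) ++ zs ≡⟨ ++-assoc xs ys zs ⟩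
  xs ++ (ys ++ zs) ⊆⟨ ⊆-reflexive-↭ (++-comm xs (ys ++ zs)) ⟩
  (ys ++ zs) ++ xs ≡⟨ ++-assoc ys zs xs ⟩
  ys ++ (zs ++ xs) ∎
  where open ⊆-Reasoning _

append-⊆ : ∀ xs {ys zs us : List A} → xs ++ ys ⊆ zs → xs ++ ys ++ us ⊆ zs ++ us
append-⊆ xs {ys} {zs} {us} h = ⊆-trans (⊆-reflexive (sym (++-assoc xs ys us))) (++⁺ˡ us h)

append-⊆ʳ : ∀ ms xs zs {ys ws us : List A} →
            xs ++ ys ⊆ ms ++ (zs ++ ws) → xs ++ ys ++ us ⊆ ms ++ (zs ++ ws ++ us)
append-⊆ʳ ms xs zs {ws = ws} {us} h = ⊆-trans (append-⊆ xs h) (⊆-reflexive (begin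
  (ms ++ (zs ++ ws)) ++ us ≡⟨ ++-assoc ms (zs ++ ws) us ⟩
  ms ++ ((zs ++ ws) ++ us) ≡⟨ cong (ms ++_) (++-assoc zs ws us) ⟩
  ms ++ (zs ++ ws ++ us)   ∎))
  where open ≡-Reasoning

append-⊆ˡ : ∀ ms xs zs {ys ws us : List A} →
            ms ++ (xs ++ ys) ⊆ zs ++ ws → ms ++ (xs ++ ys ++ us) ⊆ zs ++ ws ++ us
append-⊆ˡ ms xs zs {ys} {ws} {us} h = ⊆-trans (⊆-reflexive (begin
  ms ++ (xs ++ ys ++ us)   ≡⟨ cong (ms ++_) (++-assoc xs ys us) ⟨
  ms ++ ((xs ++ ys) ++ us) ≡⟨ ++-assoc ms (xs ++ ys) us ⟨
  (ms ++ (xs ++ ys)) ++ us ∎)) (⊆-trans (++⁺ˡ us h) (⊆-reflexive (++-assoc zs ws us)))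
  where open ≡-Reasoning

neg : Fm → Fm
neg (¬̇ α) = α
neg α     = ¬̇ α

negs : List Fm → List Fm
negs = map neg

neg∈negs : ∀ {φ M} → φ ∈ M → neg φ ∈ negs M
neg∈negs = ∈-map⁺ neg

record Sorted (f : Fm → Fm) (M K D : List Fm) : Set where
  field
    moved kept : List Fm
    moved⊆ : map f moved ⊆ M
    kept⊆  : map f kept ⊆ K
    covers : D ⊆ moved ++ kept

  image⊆ : ∀ (g : Fm → Fm) → map g D ⊆ map g moved ++ map g kept
  image⊆ g = ⊆-trans (map⁺ g covers) (⊆-reflexive (map-++ g moved kept))

  negs-moved⊆ : map (neg ∘ f) moved ⊆ negs M
  negs-moved⊆ = ⊆-trans (⊆-reflexive (map-∘ moved)) (map⁺ neg moved⊆)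

sort : ∀ f M {K} D → map f D ⊆ M ++ K → Sorted f M K D
sort f M []      h = record
  { moved = [] ; kept = [] ; moved⊆ = []⊆ ; kept⊆ = []⊆ ; covers = []⊆ }
sort f M (δ ∷ D) h with ∈-++⁻ M (h (here refl)) | sort f M D (h ∘ there)
... | inj₁ fδ∈M | s = record
  { moved = δ ∷ moved ; kept = kept
  ; moved⊆ = ∈-∷⁺ʳ fδ∈M moved⊆ ; kept⊆ = kept⊆
  ; covers = ∷⁺ʳ δ covers }
  where open Sorted s
... | inj₂ fδ∈K | s = record
  { moved = moved ; kept = δ ∷ kept
  ; moved⊆ = moved⊆ ; kept⊆ = ∈-∷⁺ʳ fδ∈K kept⊆
  ; covers = ∈-∷⁺ʳ (∈-++⁺ʳ moved (here refl))
                    (⊆-trans covers (++⁺ʳ moved (xs⊆x∷xs kept δ))) }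
  where open Sorted s

module SortedPair (f g : Fm → Fm) {M K D₁ D₂ : List Fm}
                  (cover : map f D₁ ++ map g D₂ ⊆ M ++ K) where

  sorted₁ : Sorted f M K D₁
  sorted₁ = sort f M D₁ (++-⊆⁻ˡ cover)

  sorted₂ : Sorted g M K D₂
  sorted₂ = sort g M D₂ (++-⊆⁻ʳ cover)

  open Sorted sorted₁ public using () renaming
    (moved to A₁; kept to B₁; image⊆ to image₁⊆; negs-moved⊆ to negs-moved₁⊆)
  open Sorted sorted₂ public using () renaming
    (moved to A₂; kept to B₂; image⊆ to image₂⊆; negs-moved⊆ to negs-moved₂⊆)

  M′ : List Fm
  M′ = map f A₁ ++ map g A₂

  premise-cover : map f D₁ ++ map g D₂ ⊆ M′ ++ (map f B₁ ++ map g B₂)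
  premise-cover =
    ⊆-trans (++⁺ (image₁⊆ f) (image₂⊆ g)) (⊆-medial (map f A₁) (map f B₁) (map g A₂) (map g B₂))

  kept⊆ : map f B₁ ++ map g B₂ ⊆ K
  kept⊆ = ++-⊆ (Sorted.kept⊆ sorted₁) (Sorted.kept⊆ sorted₂)

  negs-M′ : negs M′ ≡ map (neg ∘ f) A₁ ++ map (neg ∘ g) A₂
  negs-M′ = trans (map-++ neg (map f A₁) (map g A₂))
                  (sym (cong₂ _++_ (map-∘ A₁) (map-∘ A₂)))

-- Modal context formulas ◇δ, ¬□δ of a succedent that lie in M (δ ∈ A₁, A₂) are
-- moved to the antecedent context as ¬◇δ, □δ: the rule is re-instantiated with
-- Γ₁ ++ A₂, Γ₂ ++ A₁ in place of Γ₁, Γ₂ and the kept parts B₁, B₂ of Δ₁, Δ₂.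
module SplitSuccedent (M Δ Δ₁ Δ₂ : List Fm) (cover : ◇s Δ₁ ++ ¬□s Δ₂ ⊆ M ++ Δ) where
  open SortedPair ◇̇_ (λ a → ¬̇ □̇ a) {M} {Δ} {Δ₁} {Δ₂} cover public
  open ⊆-Reasoning Fm

  negs-M′⊆ : ∀ Γ₁ Γ₂ → (□s Γ₁ ++ ¬◇s Γ₂) ++ negs M′ ⊆ □s (Γ₁ ++ A₂) ++ ¬◇s (Γ₂ ++ A₁)
  negs-M′⊆ Γ₁ Γ₂ = begin
    (□s Γ₁ ++ ¬◇s Γ₂) ++ negs M′
      ≡⟨ cong ((□s Γ₁ ++ ¬◇s Γ₂) ++_) negs-M′ ⟩
    (□s Γ₁ ++ ¬◇s Γ₂) ++ (¬◇s A₁ ++ □s A₂)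
      ⊆⟨ ++⁺ʳ (□s Γ₁ ++ ¬◇s Γ₂) (⊆-reflexive-↭ (++-comm (¬◇s A₁) (□s A₂))) ⟩
    (□s Γ₁ ++ ¬◇s Γ₂) ++ (□s A₂ ++ ¬◇s A₁)
      ⊆⟨ ⊆-medial (□s Γ₁) (¬◇s Γ₂) (□s A₂) (¬◇s A₁) ⟩
    (□s Γ₁ ++ □s A₂) ++ (¬◇s Γ₂ ++ ¬◇s A₁)
      ≡⟨ cong₂ _++_ (map-++ □̇_ Γ₁ A₂) (map-++ _ Γ₂ A₁) ⟨
    □s (Γ₁ ++ A₂) ++ ¬◇s (Γ₂ ++ A₁) ∎

  context⊆ : ∀ Γ₁ Γ₂ → □s (Γ₁ ++ A₂) ++ ¬◇s (Γ₂ ++ A₁) ⊆ (□s Γ₁ ++ ¬◇s Γ₂) ++ negs M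
  context⊆ Γ₁ Γ₂ = begin
    □s (Γ₁ ++ A₂) ++ ¬◇s (Γ₂ ++ A₁)
      ≡⟨ cong₂ _++_ (map-++ □̇_ Γ₁ A₂) (map-++ _ Γ₂ A₁) ⟩
    (□s Γ₁ ++ □s A₂) ++ (¬◇s Γ₂ ++ ¬◇s A₁)
      ⊆⟨ ⊆-medial (□s Γ₁) (□s A₂) (¬◇s Γ₂) (¬◇s A₁) ⟩
    (□s Γ₁ ++ ¬◇s Γ₂) ++ (□s A₂ ++ ¬◇s A₁)
      ⊆⟨ ++⁺ʳ (□s Γ₁ ++ ¬◇s Γ₂) (++-⊆ negs-moved₂⊆ negs-moved₁⊆) ⟩
    (□s Γ₁ ++ ¬◇s Γ₂) ++ negs M ∎

  boxes⊆ : ∀ Γ₁ → □s Γ₁ ++ □s Δ₂ ⊆ □s (Γ₁ ++ A₂) ++ □s B₂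
  boxes⊆ Γ₁ = begin
    □s Γ₁ ++ □s Δ₂            ⊆⟨ ++⁺ʳ (□s Γ₁) (image₂⊆ □̇_) ⟩
    □s Γ₁ ++ (□s A₂ ++ □s B₂) ≡⟨ ++-assoc (□s Γ₁) (□s A₂) (□s B₂) ⟨
    (□s Γ₁ ++ □s A₂) ++ □s B₂ ≡⟨ cong (_++ □s B₂) (map-++ □̇_ Γ₁ A₂) ⟨
    □s (Γ₁ ++ A₂) ++ □s B₂    ∎

  diamonds⊆ : ∀ Γ₂ → ◇s Δ₁ ++ ◇s Γ₂ ⊆ ◇s B₁ ++ ◇s (Γ₂ ++ A₁)
  diamonds⊆ Γ₂ = begin
    ◇s Δ₁ ++ ◇s Γ₂            ⊆⟨ ++⁺ˡ (◇s Γ₂) (image₁⊆ ◇̇_) ⟩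
    (◇s A₁ ++ ◇s B₁) ++ ◇s Γ₂ ⊆⟨ ++-rotate-⊆ (◇s A₁) (◇s B₁) (◇s Γ₂) ⟩
    ◇s B₁ ++ (◇s Γ₂ ++ ◇s A₁) ≡⟨ cong (◇s B₁ ++_) (map-++ ◇̇_ Γ₂ A₁) ⟨
    ◇s B₁ ++ ◇s (Γ₂ ++ A₁)    ∎

-- Dually, □δ, ¬◇δ of an antecedent that lie in M move to the succedent context
-- as ¬□δ, ◇δ, with Δ₁ ++ A₂, Δ₂ ++ A₁ in place of Δ₁, Δ₂.
module SplitAntecedent (M Γ Γ₁ Γ₂ : List Fm) (cover : □s Γ₁ ++ ¬◇s Γ₂ ⊆ M ++ Γ) where
  open SortedPair □̇_ (λ a → ¬̇ ◇̇ a) {M} {Γ} {Γ₁} {Γ₂} cover public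
  open ⊆-Reasoning Fm

  negs-M′⊆ : ∀ Δ₁ Δ₂ → negs M′ ++ (◇s Δ₁ ++ ¬□s Δ₂) ⊆ ◇s (Δ₁ ++ A₂) ++ ¬□s (Δ₂ ++ A₁)
  negs-M′⊆ Δ₁ Δ₂ = begin
    negs M′ ++ (◇s Δ₁ ++ ¬□s Δ₂)
      ≡⟨ cong (_++ (◇s Δ₁ ++ ¬□s Δ₂)) negs-M′ ⟩
    (¬□s A₁ ++ ◇s A₂) ++ (◇s Δ₁ ++ ¬□s Δ₂)
      ⊆⟨ ⊆-reflexive-↭ (++-comm (¬□s A₁ ++ ◇s A₂) (◇s Δ₁ ++ ¬□s Δ₂)) ⟩
    (◇s Δ₁ ++ ¬□s Δ₂) ++ (¬□s A₁ ++ ◇s A₂)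
      ⊆⟨ ++⁺ʳ (◇s Δ₁ ++ ¬□s Δ₂) (⊆-reflexive-↭ (++-comm (¬□s A₁) (◇s A₂))) ⟩
    (◇s Δ₁ ++ ¬□s Δ₂) ++ (◇s A₂ ++ ¬□s A₁)
      ⊆⟨ ⊆-medial (◇s Δ₁) (¬□s Δ₂) (◇s A₂) (¬□s A₁) ⟩
    (◇s Δ₁ ++ ◇s A₂) ++ (¬□s Δ₂ ++ ¬□s A₁)
      ≡⟨ cong₂ _++_ (map-++ ◇̇_ Δ₁ A₂) (map-++ _ Δ₂ A₁) ⟨
    ◇s (Δ₁ ++ A₂) ++ ¬□s (Δ₂ ++ A₁) ∎

  context⊆ : ∀ Δ₁ Δ₂ → ◇s (Δ₁ ++ A₂) ++ ¬□s (Δ₂ ++ A₁) ⊆ negs M ++ (◇s Δ₁ ++ ¬□s Δ₂)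
  context⊆ Δ₁ Δ₂ = begin
    ◇s (Δ₁ ++ A₂) ++ ¬□s (Δ₂ ++ A₁)
      ≡⟨ cong₂ _++_ (map-++ ◇̇_ Δ₁ A₂) (map-++ _ Δ₂ A₁) ⟩
    (◇s Δ₁ ++ ◇s A₂) ++ (¬□s Δ₂ ++ ¬□s A₁)
      ⊆⟨ ⊆-medial (◇s Δ₁) (◇s A₂) (¬□s Δ₂) (¬□s A₁) ⟩
    (◇s Δ₁ ++ ¬□s Δ₂) ++ (◇s A₂ ++ ¬□s A₁)
      ⊆⟨ ⊆-reflexive-↭ (++-comm (◇s Δ₁ ++ ¬□s Δ₂) (◇s A₂ ++ ¬□s A₁)) ⟩
    (◇s A₂ ++ ¬□s A₁) ++ (◇s Δ₁ ++ ¬□s Δ₂)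
      ⊆⟨ ++⁺ˡ (◇s Δ₁ ++ ¬□s Δ₂) (++-⊆ negs-moved₂⊆ negs-moved₁⊆) ⟩
    negs M ++ (◇s Δ₁ ++ ¬□s Δ₂) ∎

  boxes⊆ : ∀ Δ₂ → □s Γ₁ ++ □s Δ₂ ⊆ □s B₁ ++ □s (Δ₂ ++ A₁)
  boxes⊆ Δ₂ = begin
    □s Γ₁ ++ □s Δ₂            ⊆⟨ ++⁺ˡ (□s Δ₂) (image₁⊆ □̇_) ⟩
    (□s A₁ ++ □s B₁) ++ □s Δ₂ ⊆⟨ ++-rotate-⊆ (□s A₁) (□s B₁) (□s Δ₂) ⟩
    □s B₁ ++ (□s Δ₂ ++ □s A₁) ≡⟨ cong (□s B₁ ++_) (map-++ □̇_ Δ₂ A₁) ⟨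
    □s B₁ ++ □s (Δ₂ ++ A₁)    ∎

  diamonds⊆ : ∀ Δ₁ → ◇s Δ₁ ++ ◇s Γ₂ ⊆ ◇s (Δ₁ ++ A₂) ++ ◇s B₂
  diamonds⊆ Δ₁ = begin
    ◇s Δ₁ ++ ◇s Γ₂            ⊆⟨ ++⁺ʳ (◇s Δ₁) (image₂⊆ ◇̇_) ⟩
    ◇s Δ₁ ++ (◇s A₂ ++ ◇s B₂) ≡⟨ ++-assoc (◇s Δ₁) (◇s A₂) (◇s B₂) ⟨
    (◇s Δ₁ ++ ◇s A₂) ++ ◇s B₂ ≡⟨ cong (_++ ◇s B₂) (map-++ ◇̇_ Δ₁ A₂) ⟨
    ◇s (Δ₁ ++ A₂) ++ ◇s B₂    ∎

module _ {L : Calc} where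
  private
    variable
      Γ Γ′ Δ Δ′ Θ : List Fm
      α φ : Fm

  weaken : CutFree L Γ Δ → Γ ⊆ Γ′ → Δ ⊆ Δ′ → CutFree L Γ′ Δ′
  weaken {Γ} {Δ} {Γ′} {Δ′} d Γ⊆ Δ⊆ =
    set-eq (++-⊆ ⊆-refl Γ⊆ , xs⊆xs++ys Γ′ Γ) (++-⊆ Δ⊆ ⊆-refl , xs⊆ys++xs Δ′ Δ)
      (weakenʳ* Δ′ (weakenˡ* Γ′ d))
    where
    weakenˡ* : ∀ X {Γ Δ} → CutFree L Γ Δ → CutFree L (X ++ Γ) Δ
    weakenˡ* []      d = d
    weakenˡ* (_ ∷ X) d = weL (weakenˡ* X d)

    weakenʳ* : ∀ Y {Γ Δ} → CutFree L Γ Δ → CutFree L Γ (Δ ++ Y)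
    weakenʳ* []      {Δ = Δ} d = subst (CutFree L _) (sym (++-identityʳ Δ)) d
    weakenʳ* (y ∷ Y) {Δ = Δ} d = subst (CutFree L _) (++-assoc Δ [ y ] Y) (weakenʳ* Y (weR d))

  absorbˡ : α ∈ Γ → CutFree L (α ∷ Γ) Δ → CutFree L Γ Δ
  absorbˡ α∈ d = weaken d (∈-∷⁺ʳ α∈ ⊆-refl) ⊆-refl

  absorbʳ : α ∈ Δ → CutFree L Γ (Δ ++ [ α ]) → CutFree L Γ Δ
  absorbʳ α∈ d = weaken d ⊆-refl (++-⊆ ⊆-refl [ α∈ ]⊆)

  assocʳ : ∀ xs ys {zs} → CutFree L Γ ((xs ++ ys) ++ zs) → CutFree L Γ (xs ++ ys ++ zs)
  assocʳ xs ys = subst (CutFree L _) (++-assoc xs ys _)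

  assocˡ : ∀ xs ys {zs} → CutFree L Γ (xs ++ ys ++ zs) → CutFree L Γ ((xs ++ ys) ++ zs)
  assocˡ xs ys = subst (CutFree L _) (sym (++-assoc xs ys _))

  neg⇒¬ˡ : CutFree L (neg α ∷ Γ) Δ → CutFree L (¬̇ α ∷ Γ) Δ
  neg⇒¬ˡ {α = ¬̇ _}   = ¬¬L
  neg⇒¬ˡ {α = var _}   d = d
  neg⇒¬ˡ {α = _ ∧̇ _} d = d
  neg⇒¬ˡ {α = _ ∨̇ _} d = d
  neg⇒¬ˡ {α = _ ⇒̇ _} d = d
  neg⇒¬ˡ {α = □̇ _}   d = d
  neg⇒¬ˡ {α = ◇̇ _}   d = d

  neg⇒¬ʳ : CutFree L Γ (Δ ++ [ neg α ]) → CutFree L Γ (Δ ++ [ ¬̇ α ])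
  neg⇒¬ʳ {α = ¬̇ _}   = ¬¬R
  neg⇒¬ʳ {α = var _}   d = d
  neg⇒¬ʳ {α = _ ∧̇ _} d = d
  neg⇒¬ʳ {α = _ ∨̇ _} d = d
  neg⇒¬ʳ {α = _ ⇒̇ _} d = d
  neg⇒¬ʳ {α = □̇ _}   d = d
  neg⇒¬ʳ {α = ◇̇ _}   d = d

  moved-or-keptʳ : ∀ Γ M → φ ∈ M ++ Δ →
                   CutFree L (neg φ ∷ Γ ++ negs M) Δ → CutFree L (Γ ++ negs M) (Δ ++ [ φ ]) →
                   CutFree L (Γ ++ negs M) Δ
  moved-or-keptʳ Γ M φ∈ moved kept with ∈-++⁻ M φ∈
  ... | inj₁ φ∈M = absorbˡ (∈-++⁺ʳ Γ (neg∈negs φ∈M)) moved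
  ... | inj₂ φ∈Δ = absorbʳ φ∈Δ kept

  moved-or-keptˡ : ∀ M Δ → φ ∈ M ++ Γ →
                   CutFree L Γ ((negs M ++ Δ) ++ [ neg φ ]) → CutFree L (φ ∷ Γ) (negs M ++ Δ) →
                   CutFree L Γ (negs M ++ Δ)
  moved-or-keptˡ M Δ φ∈ moved kept with ∈-++⁻ M φ∈
  ... | inj₁ φ∈M = absorbʳ (∈-++⁺ˡ (neg∈negs φ∈M)) moved
  ... | inj₂ φ∈Γ = absorbˡ φ∈Γ kept

  move-to-left : CutFree L Γ Θ → ∀ M Δ → Θ ⊆ M ++ Δ → CutFree L (Γ ++ negs M) Δ
  move-to-left (set-eq (Γ⊆ , _) (Θ⊆ , _) d) M Δ h =
    weaken (move-to-left d M Δ (⊆-trans Θ⊆ h)) (++⁺ˡ (negs M) Γ⊆) ⊆-refl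
  move-to-left (ax1 p) M Δ h =
    moved-or-keptʳ [ var p ] M (h (here refl))
      (weaken (ax3 p) (∷⁺ʳ _ (∷⁺ʳ _ []⊆)) []⊆)
      (weaken (ax1 p) (xs⊆xs++ys _ _) (xs⊆ys++xs _ Δ))
  move-to-left (ax2 p) M Δ h =
    moved-or-keptʳ [ ¬̇ var p ] M (h (here refl))
      (weaken (ax3 p) (∈-∷⁺ʳ (there (here refl)) [ here refl ]⊆) []⊆)
      (weaken (ax2 p) (xs⊆xs++ys _ _) (xs⊆ys++xs _ Δ))
  move-to-left (ax3 p) M Δ h = weaken (ax3 p) (xs⊆xs++ys _ _) []⊆
  move-to-left (ax4 p) M Δ h with ∈-++⁻ M (h (here refl)) | ∈-++⁻ M (h (there (here refl)))
  ... | inj₁ ¬p∈M | inj₁ p∈M = weaken (ax3 p) (∈-∷⁺ʳ (neg∈negs p∈M) [ neg∈negs ¬p∈M ]⊆) []⊆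
  ... | inj₁ ¬p∈M | inj₂ p∈Δ = weaken (ax1 p) [ neg∈negs ¬p∈M ]⊆ [ p∈Δ ]⊆
  ... | inj₂ ¬p∈Δ | inj₁ p∈M = weaken (ax2 p) [ neg∈negs p∈M ]⊆ [ ¬p∈Δ ]⊆
  ... | inj₂ ¬p∈Δ | inj₂ p∈Δ = weaken (ax4 p) []⊆ (∈-∷⁺ʳ ¬p∈Δ [ p∈Δ ]⊆)
  move-to-left (cut () _ _)
  move-to-left (weL d) M Δ h = weL (move-to-left d M Δ h)
  move-to-left (weR d) M Δ h = move-to-left d M Δ (++-⊆⁻ˡ h)
  move-to-left (∧L d)  M Δ h = ∧L (move-to-left d M Δ h)
  move-to-left (∨L d₁ d₂) M Δ h = ∨L (move-to-left d₁ M Δ h) (move-to-left d₂ M Δ h)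
  move-to-left (⇒L {α = α} d₁ d₂) M Δ h =
    ⇒L (move-to-left d₁ M (Δ ++ [ α ]) (extendʳ M [ α ] h)) (move-to-left d₂ M Δ h)
  move-to-left (□L d)  M Δ h = □L (move-to-left d M Δ h)
  move-to-left (¬¬L d) M Δ h = ¬¬L (move-to-left d M Δ h)
  move-to-left (¬∧L {α = α} {β} d₁ d₂) M Δ h =
    ¬∧L (move-to-left d₁ M (Δ ++ [ α ]) (extendʳ M [ α ] h))
        (move-to-left d₂ M (Δ ++ [ β ]) (extendʳ M [ β ] h))
  move-to-left (¬∨L {α = α} {β} d) M Δ h =
    ¬∨L (move-to-left d M (Δ ++ α ∷ β ∷ []) (extendʳ M (α ∷ β ∷ []) h))
  move-to-left (¬⇒L {β = β} d) M Δ h = ¬⇒L (move-to-left d M (Δ ++ [ β ]) (extendʳ M [ β ] h))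
  move-to-left (¬◇L {α = α} d) M Δ h = ¬◇L (move-to-left d M (Δ ++ [ α ]) (extendʳ M [ α ] h))
  move-to-left {Γ} (∧R {α = α} {β} d₁ d₂) M Δ h =
    moved-or-keptʳ Γ M (last∈ h) (¬∧L r₁ r₂) (∧R r₁ r₂)
    where r₁ = move-to-left d₁ M (Δ ++ [ α ]) (extendʳ M [ α ] (++-⊆⁻ˡ h))
          r₂ = move-to-left d₂ M (Δ ++ [ β ]) (extendʳ M [ β ] (++-⊆⁻ˡ h))
  move-to-left {Γ} (∨R {α = α} {β} d) M Δ h = moved-or-keptʳ Γ M (last∈ h) (¬∨L r) (∨R r)
    where r = move-to-left d M (Δ ++ α ∷ β ∷ []) (extendʳ M (α ∷ β ∷ []) (++-⊆⁻ˡ h))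
  move-to-left {Γ} (⇒R {β = β} d) M Δ h = moved-or-keptʳ Γ M (last∈ h) (¬⇒L r) (⇒R r)
    where r = move-to-left d M (Δ ++ [ β ]) (extendʳ M [ β ] (++-⊆⁻ˡ h))
  move-to-left {Γ} (◇R {α = α} d) M Δ h = moved-or-keptʳ Γ M (last∈ h) (¬◇L r) (◇R r)
    where r = move-to-left d M (Δ ++ [ α ]) (extendʳ M [ α ] (++-⊆⁻ˡ h))
  move-to-left {Γ} (¬¬R {α = α} d) M Δ h = moved-or-keptʳ Γ M (last∈ h)
    (neg⇒¬ˡ (weaken (move-to-left d (α ∷ M) Δ α-moved)
                    (⊆-reflexive-↭ (shift (neg α) Γ (negs M))) ⊆-refl))
    (¬¬R (move-to-left d M (Δ ++ [ α ]) (extendʳ M [ α ] (++-⊆⁻ˡ h))))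
    where α-moved = ++-⊆ (⊆-trans (++-⊆⁻ˡ h) (xs⊆x∷xs _ α)) [ here refl ]⊆
  move-to-left {Γ} (¬∧R d) M Δ h = moved-or-keptʳ Γ M (last∈ h) (∧L r) (¬∧R r)
    where r = move-to-left d M Δ (++-⊆⁻ˡ h)
  move-to-left {Γ} (¬∨R d₁ d₂) M Δ h = moved-or-keptʳ Γ M (last∈ h) (∨L r₁ r₂) (¬∨R r₁ r₂)
    where r₁ = move-to-left d₁ M Δ (++-⊆⁻ˡ h)
          r₂ = move-to-left d₂ M Δ (++-⊆⁻ˡ h)
  move-to-left {Γ} (¬⇒R {α = α} d₁ d₂) M Δ h = moved-or-keptʳ Γ M (last∈ h) (⇒L r₁ r₂) (¬⇒R r₁ r₂)
    where r₁ = move-to-left d₁ M (Δ ++ [ α ]) (extendʳ M [ α ] (++-⊆⁻ˡ h))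
          r₂ = move-to-left d₂ M Δ (++-⊆⁻ˡ h)
  move-to-left {Γ} (¬□R d) M Δ h = moved-or-keptʳ Γ M (last∈ h) (□L r) (¬□R r)
    where r = move-to-left d M Δ (++-⊆⁻ˡ h)
  move-to-left (□R-l {Γ₁} {Γ₂} {Δ₁} {Δ₂} {β} reflC d) M Δ h =
    moved-or-keptʳ (□s Γ₁ ++ ¬◇s Γ₂) M (h (∈-++⁺ʳ (◇s Δ₁) (∈-++⁺ʳ (¬□s Δ₂) (here refl))))
      (weaken (¬□L-l {Γ₁ = Γ₁ ++ A₂} {Γ₂ ++ A₁} {B₁} {B₂} reflC r) (∷⁺ʳ _ (context⊆ Γ₁ Γ₂)) kept⊆)
      (weaken (□R-l {Γ₁ = Γ₁ ++ A₂} {Γ₂ ++ A₁} {B₁} {B₂} reflC r)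
              (context⊆ Γ₁ Γ₂) (append-⊆ (◇s B₁) kept⊆))
    where
    open SplitSuccedent M Δ Δ₁ Δ₂ (init⊆ (◇s Δ₁) h)
    r = weaken (move-to-left d M′ (◇s B₁ ++ ¬□s B₂ ++ [ β ])
                 (append-⊆ʳ M′ (◇s Δ₁) (◇s B₁) premise-cover))
               (negs-M′⊆ Γ₁ Γ₂) ⊆-refl
  move-to-left (◇L-l {Γ₁} {Γ₂} {Δ₁} {Δ₂} {β} reflC d) M Δ h =
    weaken (◇L-l {Γ₁ = Γ₁ ++ A₂} {Γ₂ ++ A₁} {B₁} {B₂} reflC r) (∷⁺ʳ _ (context⊆ Γ₁ Γ₂)) kept⊆
    where
    open SplitSuccedent M Δ Δ₁ Δ₂ h
    r = weaken (move-to-left d M′ (◇s B₁ ++ ¬□s B₂) premise-cover)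
               (∷⁺ʳ β (negs-M′⊆ Γ₁ Γ₂)) ⊆-refl
  move-to-left (¬□L-l {Γ₁} {Γ₂} {Δ₁} {Δ₂} {β} reflC d) M Δ h =
    weaken (¬□L-l {Γ₁ = Γ₁ ++ A₂} {Γ₂ ++ A₁} {B₁} {B₂} reflC r) (∷⁺ʳ _ (context⊆ Γ₁ Γ₂)) kept⊆
    where
    open SplitSuccedent M Δ Δ₁ Δ₂ h
    r = weaken (move-to-left d M′ (◇s B₁ ++ ¬□s B₂ ++ [ β ])
                 (append-⊆ʳ M′ (◇s Δ₁) (◇s B₁) premise-cover))
               (negs-M′⊆ Γ₁ Γ₂) ⊆-refl
  move-to-left (¬◇R-l {Γ₁} {Γ₂} {Δ₁} {Δ₂} {β} reflC d) M Δ h =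
    moved-or-keptʳ (□s Γ₁ ++ ¬◇s Γ₂) M (h (∈-++⁺ʳ (◇s Δ₁) (∈-++⁺ʳ (¬□s Δ₂) (here refl))))
      (weaken (◇L-l {Γ₁ = Γ₁ ++ A₂} {Γ₂ ++ A₁} {B₁} {B₂} reflC r) (∷⁺ʳ _ (context⊆ Γ₁ Γ₂)) kept⊆)
      (weaken (¬◇R-l {Γ₁ = Γ₁ ++ A₂} {Γ₂ ++ A₁} {B₁} {B₂} reflC r)
              (context⊆ Γ₁ Γ₂) (append-⊆ (◇s B₁) kept⊆))
    where
    open SplitSuccedent M Δ Δ₁ Δ₂ (init⊆ (◇s Δ₁) h)
    r = weaken (move-to-left d M′ (◇s B₁ ++ ¬□s B₂) premise-cover)
               (∷⁺ʳ β (negs-M′⊆ Γ₁ Γ₂)) ⊆-refl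
  move-to-left (□R-g {Γ₁} {Γ₂} {Δ₁} {Δ₂} {β} reflC d) M Δ h =
    moved-or-keptʳ (□s Γ₁ ++ ¬◇s Γ₂) M (h (∈-++⁺ʳ (◇s Δ₁) (∈-++⁺ʳ (¬□s Δ₂) (here refl))))
      (weaken (¬□L-g {Γ₁ = Γ₁ ++ A₂} {Γ₂ ++ A₁} {B₁} {B₂} reflC r) (∷⁺ʳ _ (context⊆ Γ₁ Γ₂)) kept⊆)
      (weaken (□R-g {Γ₁ = Γ₁ ++ A₂} {Γ₂ ++ A₁} {B₁} {B₂} reflC r)
              (context⊆ Γ₁ Γ₂) (append-⊆ (◇s B₁) kept⊆))
    where
    open SplitSuccedent M Δ Δ₁ Δ₂ (init⊆ (◇s Δ₁) h)
    r = weaken d (boxes⊆ Γ₁) (append-⊆ʳ [] (◇s Δ₁) (◇s B₁) (diamonds⊆ Γ₂))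
  move-to-left (◇L-g {Γ₁} {Γ₂} {Δ₁} {Δ₂} {β} reflC d) M Δ h =
    weaken (◇L-g {Γ₁ = Γ₁ ++ A₂} {Γ₂ ++ A₁} {B₁} {B₂} reflC r) (∷⁺ʳ _ (context⊆ Γ₁ Γ₂)) kept⊆
    where
    open SplitSuccedent M Δ Δ₁ Δ₂ h
    r = weaken d (∷⁺ʳ β (boxes⊆ Γ₁)) (diamonds⊆ Γ₂)
  move-to-left (¬□L-g {Γ₁} {Γ₂} {Δ₁} {Δ₂} {β} reflC d) M Δ h =
    weaken (¬□L-g {Γ₁ = Γ₁ ++ A₂} {Γ₂ ++ A₁} {B₁} {B₂} reflC r) (∷⁺ʳ _ (context⊆ Γ₁ Γ₂)) kept⊆
    where
    open SplitSuccedent M Δ Δ₁ Δ₂ h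
    r = weaken d (boxes⊆ Γ₁) (append-⊆ʳ [] (◇s Δ₁) (◇s B₁) (diamonds⊆ Γ₂))
  move-to-left (¬◇R-g {Γ₁} {Γ₂} {Δ₁} {Δ₂} {β} reflC d) M Δ h =
    moved-or-keptʳ (□s Γ₁ ++ ¬◇s Γ₂) M (h (∈-++⁺ʳ (◇s Δ₁) (∈-++⁺ʳ (¬□s Δ₂) (here refl))))
      (weaken (◇L-g {Γ₁ = Γ₁ ++ A₂} {Γ₂ ++ A₁} {B₁} {B₂} reflC r) (∷⁺ʳ _ (context⊆ Γ₁ Γ₂)) kept⊆)
      (weaken (¬◇R-g {Γ₁ = Γ₁ ++ A₂} {Γ₂ ++ A₁} {B₁} {B₂} reflC r)
              (context⊆ Γ₁ Γ₂) (append-⊆ (◇s B₁) kept⊆))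
    where
    open SplitSuccedent M Δ Δ₁ Δ₂ (init⊆ (◇s Δ₁) h)
    r = weaken d (∷⁺ʳ β (boxes⊆ Γ₁)) (diamonds⊆ Γ₂)

  move-to-right : CutFree L Θ Δ → ∀ M Γ → Θ ⊆ M ++ Γ → CutFree L Γ (negs M ++ Δ)
  move-to-right (set-eq (Θ⊆ , _) (Δ⊆ , _) d) M Γ h =
    weaken (move-to-right d M Γ (⊆-trans Θ⊆ h)) ⊆-refl (++⁺ʳ (negs M) Δ⊆)
  move-to-right (ax1 p) M Γ h =
    moved-or-keptˡ M [ var p ] (h (here refl))
      (weaken (ax4 p) []⊆ (∈-∷⁺ʳ (∈-++⁺ʳ _ (here refl)) [ ∈-++⁺ˡ (∈-++⁺ʳ (negs M) (here refl)) ]⊆))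
      (weaken (ax1 p) (∷⁺ʳ _ []⊆) (xs⊆ys++xs _ (negs M)))
  move-to-right (ax2 p) M Γ h =
    moved-or-keptˡ M [ ¬̇ var p ] (h (here refl))
      (weaken (ax4 p) []⊆ (∈-∷⁺ʳ (∈-++⁺ˡ (∈-++⁺ʳ (negs M) (here refl))) [ ∈-++⁺ʳ _ (here refl) ]⊆))
      (weaken (ax2 p) (∷⁺ʳ _ []⊆) (xs⊆ys++xs _ (negs M)))
  move-to-right (ax3 p) M Γ h with ∈-++⁻ M (h (here refl)) | ∈-++⁻ M (h (there (here refl)))
  ... | inj₁ ¬p∈M | inj₁ p∈M =
    weaken (ax4 p) []⊆ (∈-∷⁺ʳ (∈-++⁺ˡ (neg∈negs p∈M)) [ ∈-++⁺ˡ (neg∈negs ¬p∈M) ]⊆)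
  ... | inj₁ ¬p∈M | inj₂ p∈Γ = weaken (ax1 p) [ p∈Γ ]⊆ [ ∈-++⁺ˡ (neg∈negs ¬p∈M) ]⊆
  ... | inj₂ ¬p∈Γ | inj₁ p∈M = weaken (ax2 p) [ ¬p∈Γ ]⊆ [ ∈-++⁺ˡ (neg∈negs p∈M) ]⊆
  ... | inj₂ ¬p∈Γ | inj₂ p∈Γ = weaken (ax3 p) (∈-∷⁺ʳ ¬p∈Γ [ p∈Γ ]⊆) []⊆
  move-to-right (ax4 p) M Γ h = weaken (ax4 p) []⊆ (xs⊆ys++xs _ (negs M))
  move-to-right (cut () _ _)
  move-to-right (weL d) M Γ h = move-to-right d M Γ (h ∘ there)
  move-to-right (weR {Δ = Δ₀} d) M Γ h = assocʳ (negs M) Δ₀ (weR (move-to-right d M Γ h))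
  move-to-right (∧L {Δ = Δ₀} {α} {β} d) M Γ h = moved-or-keptˡ M Δ₀ (h (here refl)) (¬∧R r) (∧L r)
    where r = move-to-right d M (α ∷ β ∷ Γ) (extendˡ M (α ∷ β ∷ []) (h ∘ there))
  move-to-right (∨L {Δ = Δ₀} {α} {β} d₁ d₂) M Γ h =
    moved-or-keptˡ M Δ₀ (h (here refl)) (¬∨R r₁ r₂) (∨L r₁ r₂)
    where r₁ = move-to-right d₁ M (α ∷ Γ) (extendˡ M [ α ] (h ∘ there))
          r₂ = move-to-right d₂ M (β ∷ Γ) (extendˡ M [ β ] (h ∘ there))
  move-to-right (⇒L {Δ = Δ₀} {α} {β} d₁ d₂) M Γ h =
    moved-or-keptˡ M Δ₀ (h (here refl)) (¬⇒R r₁ r₂) (⇒L r₁ r₂)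
    where r₁ = assocˡ (negs M) Δ₀ (move-to-right d₁ M Γ (h ∘ there))
          r₂ = move-to-right d₂ M (β ∷ Γ) (extendˡ M [ β ] (h ∘ there))
  move-to-right (□L {Δ = Δ₀} {α} d) M Γ h = moved-or-keptˡ M Δ₀ (h (here refl)) (¬□R r) (□L r)
    where r = move-to-right d M (α ∷ Γ) (extendˡ M [ α ] (h ∘ there))
  move-to-right (¬¬L {Δ = Δ₀} {α} d) M Γ h = moved-or-keptˡ M Δ₀ (h (here refl))
    (neg⇒¬ʳ (weaken (move-to-right d (α ∷ M) Γ (∷⁺ʳ α (h ∘ there))) ⊆-refl
                    (⊆-reflexive-↭ (++-comm [ neg α ] (negs M ++ Δ₀)))))
    (¬¬L (move-to-right d M (α ∷ Γ) (extendˡ M [ α ] (h ∘ there))))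
  move-to-right (¬∧L {Δ = Δ₀} d₁ d₂) M Γ h =
    moved-or-keptˡ M Δ₀ (h (here refl)) (∧R r₁ r₂) (¬∧L r₁ r₂)
    where r₁ = assocˡ (negs M) Δ₀ (move-to-right d₁ M Γ (h ∘ there))
          r₂ = assocˡ (negs M) Δ₀ (move-to-right d₂ M Γ (h ∘ there))
  move-to-right (¬∨L {Δ = Δ₀} d) M Γ h = moved-or-keptˡ M Δ₀ (h (here refl)) (∨R r) (¬∨L r)
    where r = assocˡ (negs M) Δ₀ (move-to-right d M Γ (h ∘ there))
  move-to-right (¬⇒L {Δ = Δ₀} {α} d) M Γ h = moved-or-keptˡ M Δ₀ (h (here refl)) (⇒R r) (¬⇒L r)
    where r = assocˡ (negs M) Δ₀ (move-to-right d M (α ∷ Γ) (extendˡ M [ α ] (h ∘ there)))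
  move-to-right (¬◇L {Δ = Δ₀} d) M Γ h = moved-or-keptˡ M Δ₀ (h (here refl)) (◇R r) (¬◇L r)
    where r = assocˡ (negs M) Δ₀ (move-to-right d M Γ (h ∘ there))
  move-to-right (∧R {Δ = Δ₀} d₁ d₂) M Γ h =
    assocʳ (negs M) Δ₀ (∧R (assocˡ (negs M) Δ₀ (move-to-right d₁ M Γ h))
                           (assocˡ (negs M) Δ₀ (move-to-right d₂ M Γ h)))
  move-to-right (∨R {Δ = Δ₀} d) M Γ h =
    assocʳ (negs M) Δ₀ (∨R (assocˡ (negs M) Δ₀ (move-to-right d M Γ h)))
  move-to-right (⇒R {Δ = Δ₀} {α} d) M Γ h =
    assocʳ (negs M) Δ₀ (⇒R (assocˡ (negs M) Δ₀ (move-to-right d M (α ∷ Γ) (extendˡ M [ α ] h))))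
  move-to-right (◇R {Δ = Δ₀} d) M Γ h =
    assocʳ (negs M) Δ₀ (◇R (assocˡ (negs M) Δ₀ (move-to-right d M Γ h)))
  move-to-right (¬¬R {Δ = Δ₀} d) M Γ h =
    assocʳ (negs M) Δ₀ (¬¬R (assocˡ (negs M) Δ₀ (move-to-right d M Γ h)))
  move-to-right (¬∧R {Δ = Δ₀} {α} {β} d) M Γ h =
    assocʳ (negs M) Δ₀ (¬∧R (move-to-right d M (α ∷ β ∷ Γ) (extendˡ M (α ∷ β ∷ []) h)))
  move-to-right (¬∨R {Δ = Δ₀} {α} {β} d₁ d₂) M Γ h =
    assocʳ (negs M) Δ₀ (¬∨R (move-to-right d₁ M (α ∷ Γ) (extendˡ M [ α ] h))
                            (move-to-right d₂ M (β ∷ Γ) (extendˡ M [ β ] h)))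
  move-to-right (¬⇒R {Δ = Δ₀} {β = β} d₁ d₂) M Γ h =
    assocʳ (negs M) Δ₀ (¬⇒R (assocˡ (negs M) Δ₀ (move-to-right d₁ M Γ h))
                            (move-to-right d₂ M (β ∷ Γ) (extendˡ M [ β ] h)))
  move-to-right (¬□R {Δ = Δ₀} {α} d) M Γ h =
    assocʳ (negs M) Δ₀ (¬□R (move-to-right d M (α ∷ Γ) (extendˡ M [ α ] h)))
  move-to-right (□R-l {Γ₁} {Γ₂} {Δ₁} {Δ₂} {β} reflC d) M Γ h =
    weaken (□R-l {Γ₁ = B₁} {B₂} {Δ₁ ++ A₂} {Δ₂ ++ A₁} reflC r) kept⊆
           (append-⊆ʳ (negs M) (◇s (Δ₁ ++ A₂)) (◇s Δ₁) (context⊆ Δ₁ Δ₂))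
    where
    open SplitAntecedent M Γ Γ₁ Γ₂ h
    r = weaken (move-to-right d M′ (□s B₁ ++ ¬◇s B₂) premise-cover) ⊆-refl
               (append-⊆ˡ (negs M′) (◇s Δ₁) (◇s (Δ₁ ++ A₂)) (negs-M′⊆ Δ₁ Δ₂))
  move-to-right (◇L-l {Γ₁} {Γ₂} {Δ₁} {Δ₂} {β} reflC d) M Γ h =
    moved-or-keptˡ M (◇s Δ₁ ++ ¬□s Δ₂) (h (here refl))
      (weaken (¬◇R-l {Γ₁ = B₁} {B₂} {Δ₁ ++ A₂} {Δ₂ ++ A₁} reflC r)
              kept⊆ (append-⊆ (◇s (Δ₁ ++ A₂)) (context⊆ Δ₁ Δ₂)))
      (weaken (◇L-l {Γ₁ = B₁} {B₂} {Δ₁ ++ A₂} {Δ₂ ++ A₁} reflC r) (∷⁺ʳ _ kept⊆) (context⊆ Δ₁ Δ₂))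
    where
    open SplitAntecedent M Γ Γ₁ Γ₂ (h ∘ there)
    r = weaken (move-to-right d M′ (β ∷ □s B₁ ++ ¬◇s B₂) (extendˡ M′ [ β ] premise-cover))
               ⊆-refl (negs-M′⊆ Δ₁ Δ₂)
  move-to-right (¬□L-l {Γ₁} {Γ₂} {Δ₁} {Δ₂} {β} reflC d) M Γ h =
    moved-or-keptˡ M (◇s Δ₁ ++ ¬□s Δ₂) (h (here refl))
      (weaken (□R-l {Γ₁ = B₁} {B₂} {Δ₁ ++ A₂} {Δ₂ ++ A₁} reflC r)
              kept⊆ (append-⊆ (◇s (Δ₁ ++ A₂)) (context⊆ Δ₁ Δ₂)))
      (weaken (¬□L-l {Γ₁ = B₁} {B₂} {Δ₁ ++ A₂} {Δ₂ ++ A₁} reflC r) (∷⁺ʳ _ kept⊆) (context⊆ Δ₁ Δ₂))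
    where
    open SplitAntecedent M Γ Γ₁ Γ₂ (h ∘ there)
    r = weaken (move-to-right d M′ (□s B₁ ++ ¬◇s B₂) premise-cover) ⊆-refl
               (append-⊆ˡ (negs M′) (◇s Δ₁) (◇s (Δ₁ ++ A₂)) (negs-M′⊆ Δ₁ Δ₂))
  move-to-right (¬◇R-l {Γ₁} {Γ₂} {Δ₁} {Δ₂} {β} reflC d) M Γ h =
    weaken (¬◇R-l {Γ₁ = B₁} {B₂} {Δ₁ ++ A₂} {Δ₂ ++ A₁} reflC r) kept⊆
           (append-⊆ʳ (negs M) (◇s (Δ₁ ++ A₂)) (◇s Δ₁) (context⊆ Δ₁ Δ₂))
    where
    open SplitAntecedent M Γ Γ₁ Γ₂ h
    r = weaken (move-to-right d M′ (β ∷ □s B₁ ++ ¬◇s B₂) (extendˡ M′ [ β ] premise-cover))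
               ⊆-refl (negs-M′⊆ Δ₁ Δ₂)
  move-to-right (□R-g {Γ₁} {Γ₂} {Δ₁} {Δ₂} {β} reflC d) M Γ h =
    weaken (□R-g {Γ₁ = B₁} {B₂} {Δ₁ ++ A₂} {Δ₂ ++ A₁} reflC r) kept⊆
           (append-⊆ʳ (negs M) (◇s (Δ₁ ++ A₂)) (◇s Δ₁) (context⊆ Δ₁ Δ₂))
    where
    open SplitAntecedent M Γ Γ₁ Γ₂ h
    r = weaken d (boxes⊆ Δ₂) (append-⊆ʳ [] (◇s Δ₁) (◇s (Δ₁ ++ A₂)) (diamonds⊆ Δ₁))
  move-to-right (◇L-g {Γ₁} {Γ₂} {Δ₁} {Δ₂} {β} reflC d) M Γ h =
    moved-or-keptˡ M (◇s Δ₁ ++ ¬□s Δ₂) (h (here refl))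
      (weaken (¬◇R-g {Γ₁ = B₁} {B₂} {Δ₁ ++ A₂} {Δ₂ ++ A₁} reflC r)
              kept⊆ (append-⊆ (◇s (Δ₁ ++ A₂)) (context⊆ Δ₁ Δ₂)))
      (weaken (◇L-g {Γ₁ = B₁} {B₂} {Δ₁ ++ A₂} {Δ₂ ++ A₁} reflC r) (∷⁺ʳ _ kept⊆) (context⊆ Δ₁ Δ₂))
    where
    open SplitAntecedent M Γ Γ₁ Γ₂ (h ∘ there)
    r = weaken d (∷⁺ʳ β (boxes⊆ Δ₂)) (diamonds⊆ Δ₁)
  move-to-right (¬□L-g {Γ₁} {Γ₂} {Δ₁} {Δ₂} {β} reflC d) M Γ h =
    moved-or-keptˡ M (◇s Δ₁ ++ ¬□s Δ₂) (h (here refl))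
      (weaken (□R-g {Γ₁ = B₁} {B₂} {Δ₁ ++ A₂} {Δ₂ ++ A₁} reflC r)
              kept⊆ (append-⊆ (◇s (Δ₁ ++ A₂)) (context⊆ Δ₁ Δ₂)))
      (weaken (¬□L-g {Γ₁ = B₁} {B₂} {Δ₁ ++ A₂} {Δ₂ ++ A₁} reflC r) (∷⁺ʳ _ kept⊆) (context⊆ Δ₁ Δ₂))
    where
    open SplitAntecedent M Γ Γ₁ Γ₂ (h ∘ there)
    r = weaken d (boxes⊆ Δ₂) (append-⊆ʳ [] (◇s Δ₁) (◇s (Δ₁ ++ A₂)) (diamonds⊆ Δ₁))
  move-to-right (¬◇R-g {Γ₁} {Γ₂} {Δ₁} {Δ₂} {β} reflC d) M Γ h =
    weaken (¬◇R-g {Γ₁ = B₁} {B₂} {Δ₁ ++ A₂} {Δ₂ ++ A₁} reflC r) kept⊆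
           (append-⊆ʳ (negs M) (◇s (Δ₁ ++ A₂)) (◇s Δ₁) (context⊆ Δ₁ Δ₂))
    where
    open SplitAntecedent M Γ Γ₁ Γ₂ h
    r = weaken d (∷⁺ʳ β (boxes⊆ Δ₂)) (diamonds⊆ Δ₁)

theorem4p2 : (L : Calc) →
    Admissible₁ L ¬left⁻¹-prem ¬left⁻¹-concl × Admissible₁ L ¬right⁻¹-prem ¬right⁻¹-concl
theorem4p2 L = ¬left⁻¹ , ¬right⁻¹
  where
  ¬left⁻¹ : Admissible₁ L ¬left⁻¹-prem ¬left⁻¹-concl
  ¬left⁻¹ Γ Δ α d =
    weaken (move-to-left d [ ¬̇ α ] Δ (⊆-reflexive-↭ (++-comm Δ [ ¬̇ α ])))
           (⊆-reflexive-↭ (++-comm Γ [ α ])) ⊆-refl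
  ¬right⁻¹ : Admissible₁ L ¬right⁻¹-prem ¬right⁻¹-concl
  ¬right⁻¹ Γ Δ α d =
    weaken (move-to-right d [ ¬̇ α ] Γ ⊆-refl) ⊆-refl (⊆-reflexive-↭ (++-comm [ α ] Δ))
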